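{- Let $n\ge0$ and $N=\lfloor n/2\rfloor$, and let $\mathcal{B}=\{q^j(1+q)^{n-2j}\}_{j=0}^{N}$ and $\mathcal{S}=\{q^jS_{n-2j}(q)\}_{j=0}^{N}$ be the bases of $\mathcal{P}_n(q)$. Then the transition matrix $M(\mathcal{B},\mathcal{S})=(c_{i,j})_{0\le i,j\le N}$ satisfies $c_{i,j}=0$ for $i<j$, $c_{j,j}=1$, and $$c_{i,j}=(-1)^{i-j}\frac{n-2j}{n-i-j}\binom{n-i-j}{i-j}$$ for $0\le j\le i\le N$ with $(i,j)\neq(n/2,n/2)$. Equivalently, for each $0\le j\le N$, $q^jS_{n-2j}(q)=\sum_{i=j}^{N}c_{i,j}\,q^i(1+q)^{n-2i}$.
   Context: For a nonzero real polynomial $f(q)=a_rq^r+\cdots+a_sq^s$ with $a_r\neq 0$, $a_s\neq 0$, its darga is $r+s$, and $f$ is palindromic if $a_{r+i}=a_{s-i}$ for all $i$. $\mathcal{P}_n(q)$ is the real vector space of palindromic polynomials of darga $n$ (including $0$). $S_0(q)=1$ and $S_j(q)=1+q^j$ for $j\ge1$. For ordered bases $\mathcal{F}=(u_0,\dots,u_N)$ and $\mathcal{G}=(v_0,\dots,v_N)$ of $\mathcal{P}_n(q)$, the transition matrix $M(\mathcal{F},\mathcal{G})=(m_{i,j})$ is defined by $v_j=\sum_i m_{i,j}u_i$.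
   Formalization: The coefficients of the polynomials in $\mathcal{P}_n(q)$ and the entries of the transition matrix are rational rather than real. -}

module Defs where

open import Data.Nat as ℕ using (ℕ; zero; suc; _∸_)
open import Data.Nat.Combinatorics using (_C_)
open import Data.Integer as ℤ using (ℤ; +_)
open import Data.Rational as ℚ using (ℚ; 0ℚ; 1ℚ; _+_; _*_; -_)
open import Data.Fin as Fin using (Fin; toℕ)
open import Relation.Binary.PropositionalEquality using (_≡_)

-- Polynomials in q with rational coefficients, represented by their
-- coefficient sequence: (p k) is the coefficient of q^k.
Poly : Set
Poly = ℕ → ℚ

_≈ₚ_ : Poly → Poly → Set
p ≈ₚ r = ∀ k → p k ≡ r k
infix 4 _≈ₚ_

zeroₚ : Poly
zeroₚ _ = 0ℚ

oneₚ : Poly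
oneₚ zero    = 1ℚ
oneₚ (suc _) = 0ℚ

qₚ : Poly
qₚ zero          = 0ℚ
qₚ (suc zero)    = 1ℚ
qₚ (suc (suc _)) = 0ℚ

_+ₚ_ : Poly → Poly → Poly
(p +ₚ r) k = p k + r k
infixl 6 _+ₚ_

sumTo : ℕ → (ℕ → ℚ) → ℚ
sumTo zero    f = f 0
sumTo (suc k) f = sumTo k f + f (suc k)

_*ₚ_ : Poly → Poly → Poly
(p *ₚ r) k = sumTo k (λ t → p t * r (k ∸ t))
infixl 7 _*ₚ_

_·ₚ_ : ℚ → Poly → Poly
(c ·ₚ p) k = c * p k
infixl 7 _·ₚ_

_^ₚ_ : Poly → ℕ → Poly
p ^ₚ zero  = oneₚ
p ^ₚ suc m = p *ₚ (p ^ₚ m)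

sumFinₚ : ∀ {m} → (Fin m → Poly) → Poly
sumFinₚ {zero}  f = zeroₚ
sumFinₚ {suc m} f = f Fin.zero +ₚ sumFinₚ (λ i → f (Fin.suc i))

S : ℕ → Poly
S zero    = oneₚ
S (suc j) = oneₚ +ₚ (qₚ ^ₚ suc j)

basisB : (n : ℕ) → ℕ → Poly
basisB n i = (qₚ ^ₚ i) *ₚ ((oneₚ +ₚ qₚ) ^ₚ (n ∸ 2 ℕ.* i))

basisS : (n : ℕ) → ℕ → Poly
basisS n j = (qₚ ^ₚ j) *ₚ S (n ∸ 2 ℕ.* j)

IsTransitionBS : (n : ℕ) → (Fin (suc (n ℕ./ 2)) → Fin (suc (n ℕ./ 2)) → ℚ) → Set
IsTransitionBS n m =
  ∀ (j : Fin (suc (n ℕ./ 2))) →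
    basisS n (toℕ j) ≈ₚ sumFinₚ (λ i → m i j ·ₚ basisB n (toℕ i))

_^ℚ_ : ℚ → ℕ → ℚ
x ^ℚ zero  = 1ℚ
x ^ℚ suc k = x * (x ^ℚ k)

-- a / d as a rational; only used when d ≠ 0 (the value at d = 0 is junk)
frac : ℤ → ℕ → ℚ
frac a zero    = 0ℚ
frac a (suc d) = a ℚ./ suc d

cFormula : (n i j : ℕ) → ℚ
cFormula n i j =
  ((- 1ℚ) ^ℚ (i ∸ j)) * frac (+ (n ∸ 2 ℕ.* j)) (n ∸ i ∸ j)
    * ((+ ((n ∸ i ∸ j) C (i ∸ j))) ℚ./ 1)

-- Column j of M(B,S) expands q^j S_m, m = n-2j, so everything rests on the identity
--     1 + q^m = Σ_k (-1)^k m/(m-k) C(m-k,k) q^k (1+q)^(m-2k)        (m ≥ 1).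
-- Coefficient families c whose rows obey c(m+2,k) = c(m+1,k) - c(m,k-1) have
-- expansions E(m) = Σ_k c(m,k) q^k (1+q)^(m-2k) with E(m+2) = (1+q)E(m+1) - qE(m)
-- (expansion-recurrence).  By Pascal's rule the Chebyshev coefficients (-1)^k C(m-k,k)
-- are such a family, so their expansion is the q-integer [m+1]_q = 1 + ... + q^m,
-- which satisfies the same recurrence.  By absorption the Lucas coefficients above are
-- differences of Chebyshev ones, whence the Lucas expansion is [m+1]_q - q[m-1]_q = 1 + q^m.
module Submission where

open import Defs
open import Data.Nat using (ℕ; suc; _/_; _*_; _≤_; _<_)
open import Data.Fin using (Fin; toℕ)
open import Data.Rational using (ℚ; 0ℚ; 1ℚ)
open import Data.Product using (_×_)
open import Relation.Binary.PropositionalEquality using (_≡_)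
open import Relation.Nullary using (¬_)
open import Function.Bundles using (_⇔_)

open import Data.Nat using (zero; _+_; _∸_; z≤n; s≤s)
import Data.Nat.Properties as ℕₚ
open import Data.Nat.Combinatorics using (_C_; k>n⇒nCk≡0; nC1≡n; nCk+nC[k+1]≡[n+1]C[k+1])
import Data.Nat as ℕ
import Data.Nat.DivMod as ℕ
import Data.Rational as ℚ
import Data.Rational.Properties as ℚₚ
import Data.Rational.Unnormalised as ℚᵘ
import Data.Rational.Unnormalised.Properties as ℚᵘₚ
import Data.Integer as ℤ
import Data.Integer.Properties as ℤₚ
open import Data.Integer using (+_)
import Data.Fin as Fin
import Data.Fin.Properties as Finₚ
open import Data.Product using (_,_; proj₁; proj₂)
open import Data.Sum using (_⊎_; inj₁; inj₂)
open import Function using (_∘_)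
open import Function.Bundles using (mk⇔)
open import Relation.Binary.Bundles using (Setoid)
open import Relation.Binary.Definitions using (Tri; tri<; tri≈; tri>)
open import Relation.Binary.PropositionalEquality using (refl; sym; trans; cong; cong₂; subst; module ≡-Reasoning)
open import Relation.Nullary using (Dec; yes; no; contradiction)
import Relation.Binary.Reasoning.Setoid as SetoidReasoning
open import Algebra.Properties.Group ℚₚ.+-0-group using () renaming (∙-cancelˡ to +-cancelˡ)
open import Tactic.RingSolver using (solve-∀)
open import Tactic.RingSolver.Core.AlmostCommutativeRing using (AlmostCommutativeRing; fromCommutativeRing)
open import Relation.Nullary.Decidable.Core using (dec⇒maybe)
import Data.Nat.Tactic.RingSolver as ℕSolver
import Data.Integer.Tactic.RingSolver as ℤSolver

ℚ-ring : AlmostCommutativeRing _ _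
ℚ-ring = fromCommutativeRing ℚₚ.+-*-commutativeRing (λ x → dec⇒maybe (0ℚ ℚₚ.≟ x))

+-interchange : ∀ (a b c d : ℚ) → (a ℚ.+ b) ℚ.+ (c ℚ.+ d) ≡ (a ℚ.+ c) ℚ.+ (b ℚ.+ d)
+-interchange = solve-∀ ℚ-ring

≈ₚ-refl : ∀ {p : Poly} → p ≈ₚ p
≈ₚ-refl k = refl

≈ₚ-sym : ∀ {p r : Poly} → p ≈ₚ r → r ≈ₚ p
≈ₚ-sym e k = sym (e k)

≈ₚ-trans : ∀ {p r s : Poly} → p ≈ₚ r → r ≈ₚ s → p ≈ₚ s
≈ₚ-trans e f k = trans (e k) (f k)

≈ₚ-setoid : Setoid _ _
≈ₚ-setoid = record
  { Carrier = Poly ; _≈_ = _≈ₚ_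
  ; isEquivalence = record { refl = λ {p} → ≈ₚ-refl {p} ; sym = ≈ₚ-sym ; trans = ≈ₚ-trans } }

module ≈ₚ-Reasoning = SetoidReasoning ≈ₚ-setoid

+ₚ-cong : ∀ {p p′ r r′} → p ≈ₚ p′ → r ≈ₚ r′ → p +ₚ r ≈ₚ p′ +ₚ r′
+ₚ-cong e f k = cong₂ ℚ._+_ (e k) (f k)

·ₚ-congˡ : ∀ {c c′} p → c ≡ c′ → c ·ₚ p ≈ₚ c′ ·ₚ p
·ₚ-congˡ p e k = cong (ℚ._* p k) e

·ₚ-congʳ : ∀ c {p p′} → p ≈ₚ p′ → c ·ₚ p ≈ₚ c ·ₚ p′
·ₚ-congʳ c f k = cong (c ℚ.*_) (f k)

+ₚ-identityʳ : ∀ p → p +ₚ zeroₚ ≈ₚ p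
+ₚ-identityʳ p k = ℚₚ.+-identityʳ (p k)

+ₚ-identityˡ : ∀ p → zeroₚ +ₚ p ≈ₚ p
+ₚ-identityˡ p k = ℚₚ.+-identityˡ (p k)

·ₚ-zeroʳ : ∀ c → c ·ₚ zeroₚ ≈ₚ zeroₚ
·ₚ-zeroʳ c k = ℚₚ.*-zeroʳ c

·ₚ-zeroˡ : ∀ p → 0ℚ ·ₚ p ≈ₚ zeroₚ
·ₚ-zeroˡ p k = ℚₚ.*-zeroˡ (p k)

·ₚ-vanish : ∀ {c} p → c ≡ 0ℚ → c ·ₚ p ≈ₚ zeroₚ
·ₚ-vanish p c≡0 = ≈ₚ-trans (·ₚ-congˡ p c≡0) (·ₚ-zeroˡ p)

·ₚ-identityˡ : ∀ p → 1ℚ ·ₚ p ≈ₚ p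
·ₚ-identityˡ p k = ℚₚ.*-identityˡ (p k)

·ₚ-assoc : ∀ a b p → a ·ₚ (b ·ₚ p) ≈ₚ (a ℚ.* b) ·ₚ p
·ₚ-assoc a b p k = sym (ℚₚ.*-assoc a b (p k))

·ₚ-distribʳ : ∀ a b p → (a ℚ.+ b) ·ₚ p ≈ₚ a ·ₚ p +ₚ b ·ₚ p
·ₚ-distribʳ a b p k = ℚₚ.*-distribʳ-+ (p k) a b

·ₚ-distribˡ : ∀ c p r → c ·ₚ (p +ₚ r) ≈ₚ c ·ₚ p +ₚ c ·ₚ r
·ₚ-distribˡ c p r k = ℚₚ.*-distribˡ-+ c (p k) (r k)

-- Multiplication by q moves every coefficient one degree up.
shift : Poly → Poly
shift p zero    = 0ℚ
shift p (suc k) = p k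

shiftBy : ℕ → Poly → Poly
shiftBy zero    p = p
shiftBy (suc i) p = shift (shiftBy i p)

shift-cong : ∀ {p r} → p ≈ₚ r → shift p ≈ₚ shift r
shift-cong e zero    = refl
shift-cong e (suc k) = e k

shift-+ₚ : ∀ p r → shift (p +ₚ r) ≈ₚ shift p +ₚ shift r
shift-+ₚ p r zero    = sym (ℚₚ.+-identityʳ 0ℚ)
shift-+ₚ p r (suc k) = refl

shift-·ₚ : ∀ c p → shift (c ·ₚ p) ≈ₚ c ·ₚ shift p
shift-·ₚ c p zero    = sym (ℚₚ.*-zeroʳ c)
shift-·ₚ c p (suc k) = refl

shiftBy-cong : ∀ i {p r} → p ≈ₚ r → shiftBy i p ≈ₚ shiftBy i r
shiftBy-cong zero    e = e
shiftBy-cong (suc i) e = shift-cong (shiftBy-cong i e)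

shiftBy-·ₚ : ∀ i c p → shiftBy i (c ·ₚ p) ≈ₚ c ·ₚ shiftBy i p
shiftBy-·ₚ zero    c p = ≈ₚ-refl
shiftBy-·ₚ (suc i) c p = ≈ₚ-trans (shift-cong (shiftBy-·ₚ i c p)) (shift-·ₚ c (shiftBy i p))

shiftBy-+ₚ : ∀ i p r → shiftBy i (p +ₚ r) ≈ₚ shiftBy i p +ₚ shiftBy i r
shiftBy-+ₚ zero    p r = ≈ₚ-refl
shiftBy-+ₚ (suc i) p r = ≈ₚ-trans (shift-cong (shiftBy-+ₚ i p r)) (shift-+ₚ (shiftBy i p) (shiftBy i r))

shiftBy-+ : ∀ i j p → shiftBy (i + j) p ≡ shiftBy i (shiftBy j p)
shiftBy-+ zero    j p = refl
shiftBy-+ (suc i) j p = cong shift (shiftBy-+ i j p)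

shift-shiftBy : ∀ i p → shift (shiftBy i p) ≡ shiftBy i (shift p)
shift-shiftBy zero    p = refl
shift-shiftBy (suc i) p = cong shift (shift-shiftBy i p)

shiftBy-below : ∀ i p k → k < i → shiftBy i p k ≡ 0ℚ
shiftBy-below (suc i) p zero    _         = refl
shiftBy-below (suc i) p (suc k) (s≤s k<i) = shiftBy-below i p k k<i

shiftBy-at : ∀ i p → shiftBy i p i ≡ p 0
shiftBy-at zero    p = refl
shiftBy-at (suc i) p = shiftBy-at i p

sumTo-cong : ∀ k {f g : ℕ → ℚ} → (∀ t → f t ≡ g t) → sumTo k f ≡ sumTo k g
sumTo-cong zero    e = e 0
sumTo-cong (suc k) e = cong₂ ℚ._+_ (sumTo-cong k e) (e (suc k))

sumTo-uncons : ∀ k (f : ℕ → ℚ) → sumTo (suc k) f ≡ f 0 ℚ.+ sumTo k (f ∘ suc)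
sumTo-uncons zero    f = refl
sumTo-uncons (suc k) f = begin
  (sumTo (suc k) f ℚ.+ f (suc (suc k)))         ≡⟨ cong (ℚ._+ f (suc (suc k))) (sumTo-uncons k f) ⟩
  (f 0 ℚ.+ sumTo k (f ∘ suc)) ℚ.+ f (suc (suc k)) ≡⟨ ℚₚ.+-assoc (f 0) _ _ ⟩
  f 0 ℚ.+ sumTo (suc k) (f ∘ suc)               ∎
  where open ≡-Reasoning

sumTo-+ : ∀ k (f g : ℕ → ℚ) → sumTo k (λ t → f t ℚ.+ g t) ≡ sumTo k f ℚ.+ sumTo k g
sumTo-+ zero    f g = refl
sumTo-+ (suc k) f g = trans (cong (ℚ._+ (f (suc k) ℚ.+ g (suc k))) (sumTo-+ k f g))
                            (+-interchange (sumTo k f) (sumTo k g) (f (suc k)) (g (suc k)))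

sumTo-zero : ∀ k (f : ℕ → ℚ) → (∀ t → f t ≡ 0ℚ) → sumTo k f ≡ 0ℚ
sumTo-zero zero    f z = z 0
sumTo-zero (suc k) f z = cong₂ ℚ._+_ (sumTo-zero k f z) (z (suc k))

*ₚ-congˡ : ∀ {a b} p → a ≈ₚ b → a *ₚ p ≈ₚ b *ₚ p
*ₚ-congˡ p e k = sumTo-cong k (λ t → cong (ℚ._* p (k ∸ t)) (e t))

*ₚ-distribʳ : ∀ a b p → (a +ₚ b) *ₚ p ≈ₚ a *ₚ p +ₚ b *ₚ p
*ₚ-distribʳ a b p k =
  trans (sumTo-cong k (λ t → ℚₚ.*-distribʳ-+ (p (k ∸ t)) (a t) (b t))) (sumTo-+ k _ _)

*ₚ-identityˡ : ∀ p → oneₚ *ₚ p ≈ₚ p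
*ₚ-identityˡ p zero    = ℚₚ.*-identityˡ (p 0)
*ₚ-identityˡ p (suc k) = begin
  sumTo (suc k) (λ t → oneₚ t ℚ.* p (suc k ∸ t))             ≡⟨ sumTo-uncons k (λ t → oneₚ t ℚ.* p (suc k ∸ t)) ⟩
  1ℚ ℚ.* p (suc k) ℚ.+ sumTo k (λ t → 0ℚ ℚ.* p (k ∸ t))     ≡⟨ cong₂ ℚ._+_ (ℚₚ.*-identityˡ (p (suc k))) (sumTo-zero k _ (λ t → ℚₚ.*-zeroˡ (p (k ∸ t)))) ⟩
  p (suc k) ℚ.+ 0ℚ                                           ≡⟨ ℚₚ.+-identityʳ _ ⟩
  p (suc k)                                                  ∎
  where open ≡-Reasoning

shift-*ₚ : ∀ a p → shift a *ₚ p ≈ₚ shift (a *ₚ p)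
shift-*ₚ a p zero    = ℚₚ.*-zeroˡ (p 0)
shift-*ₚ a p (suc k) = begin
  sumTo (suc k) (λ t → shift a t ℚ.* p (suc k ∸ t))         ≡⟨ sumTo-uncons k (λ t → shift a t ℚ.* p (suc k ∸ t)) ⟩
  0ℚ ℚ.* p (suc k) ℚ.+ sumTo k (λ t → a t ℚ.* p (k ∸ t))   ≡⟨ cong (ℚ._+ sumTo k (λ t → a t ℚ.* p (k ∸ t))) (ℚₚ.*-zeroˡ (p (suc k))) ⟩
  0ℚ ℚ.+ sumTo k (λ t → a t ℚ.* p (k ∸ t))                 ≡⟨ ℚₚ.+-identityˡ _ ⟩
  (a *ₚ p) k                                                ∎
  where open ≡-Reasoning

qₚ≈shift-oneₚ : qₚ ≈ₚ shift oneₚ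
qₚ≈shift-oneₚ zero          = refl
qₚ≈shift-oneₚ (suc zero)    = refl
qₚ≈shift-oneₚ (suc (suc k)) = refl

qₚ-*ₚ : ∀ p → qₚ *ₚ p ≈ₚ shift p
qₚ-*ₚ p = ≈ₚ-trans (*ₚ-congˡ p qₚ≈shift-oneₚ)
                    (≈ₚ-trans (shift-*ₚ oneₚ p) (shift-cong (*ₚ-identityˡ p)))

qₚ^-*ₚ : ∀ i p → (qₚ ^ₚ i) *ₚ p ≈ₚ shiftBy i p
qₚ^-*ₚ zero    p = *ₚ-identityˡ p
qₚ^-*ₚ (suc i) p = begin
  (qₚ *ₚ (qₚ ^ₚ i)) *ₚ p   ≈⟨ *ₚ-congˡ p (qₚ-*ₚ (qₚ ^ₚ i)) ⟩
  shift (qₚ ^ₚ i) *ₚ p     ≈⟨ shift-*ₚ (qₚ ^ₚ i) p ⟩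
  shift ((qₚ ^ₚ i) *ₚ p)   ≈⟨ shift-cong (qₚ^-*ₚ i p) ⟩
  shiftBy (suc i) p        ∎
  where open ≈ₚ-Reasoning

qₚ^≈ : ∀ i → qₚ ^ₚ i ≈ₚ shiftBy i oneₚ
qₚ^≈ zero    = ≈ₚ-refl
qₚ^≈ (suc i) = ≈ₚ-trans (qₚ-*ₚ (qₚ ^ₚ i)) (shift-cong (qₚ^≈ i))

onePlusQ^ : ℕ → Poly
onePlusQ^ zero    = oneₚ
onePlusQ^ (suc a) = onePlusQ^ a +ₚ shift (onePlusQ^ a)

onePlusQ^-correct : ∀ a → (oneₚ +ₚ qₚ) ^ₚ a ≈ₚ onePlusQ^ a
onePlusQ^-correct zero    = ≈ₚ-refl
onePlusQ^-correct (suc a) = begin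
  (oneₚ +ₚ qₚ) *ₚ P                   ≈⟨ *ₚ-distribʳ oneₚ qₚ P ⟩
  oneₚ *ₚ P +ₚ qₚ *ₚ P                ≈⟨ +ₚ-cong (*ₚ-identityˡ P) (qₚ-*ₚ P) ⟩
  P +ₚ shift P                        ≈⟨ +ₚ-cong (onePlusQ^-correct a) (shift-cong (onePlusQ^-correct a)) ⟩
  onePlusQ^ (suc a)                   ∎
  where
  P = (oneₚ +ₚ qₚ) ^ₚ a
  open ≈ₚ-Reasoning

onePlusQ^-constant : ∀ a → onePlusQ^ a 0 ≡ 1ℚ
onePlusQ^-constant zero    = refl
onePlusQ^-constant (suc a) = trans (ℚₚ.+-identityʳ (onePlusQ^ a 0)) (onePlusQ^-constant a)

basisB≈ : ∀ n i → basisB n i ≈ₚ shiftBy i (onePlusQ^ (n ∸ 2 * i))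
basisB≈ n i = ≈ₚ-trans (qₚ^-*ₚ i _) (shiftBy-cong i (onePlusQ^-correct (n ∸ 2 * i)))

basisS≈ : ∀ n j → basisS n j ≈ₚ shiftBy j (S (n ∸ 2 * j))
basisS≈ n j = qₚ^-*ₚ j _

S-suc≈ : ∀ m → S (suc m) ≈ₚ oneₚ +ₚ shiftBy (suc m) oneₚ
S-suc≈ m = +ₚ-cong {p = oneₚ} ≈ₚ-refl (qₚ^≈ (suc m))

Σ< : ℕ → (ℕ → Poly) → Poly
Σ< zero    f = zeroₚ
Σ< (suc K) f = f 0 +ₚ Σ< K (f ∘ suc)

Σ<-cong : ∀ K {f g : ℕ → Poly} → (∀ k → f k ≈ₚ g k) → Σ< K f ≈ₚ Σ< K g
Σ<-cong zero    e = ≈ₚ-refl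
Σ<-cong (suc K) e = +ₚ-cong (e 0) (Σ<-cong K (e ∘ suc))

Σ<-+ₚ : ∀ K (f g : ℕ → Poly) → Σ< K (λ k → f k +ₚ g k) ≈ₚ Σ< K f +ₚ Σ< K g
Σ<-+ₚ zero    f g t = sym (ℚₚ.+-identityʳ 0ℚ)
Σ<-+ₚ (suc K) f g t = trans (cong (f 0 t ℚ.+ g 0 t ℚ.+_) (Σ<-+ₚ K (f ∘ suc) (g ∘ suc) t))
                             (+-interchange (f 0 t) (g 0 t) _ _)

Σ<-·ₚ : ∀ K c (f : ℕ → Poly) → Σ< K (λ k → c ·ₚ f k) ≈ₚ c ·ₚ Σ< K f
Σ<-·ₚ zero    c f t = sym (ℚₚ.*-zeroʳ c)
Σ<-·ₚ (suc K) c f t = trans (cong (c ℚ.* f 0 t ℚ.+_) (Σ<-·ₚ K c (f ∘ suc) t))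
                             (sym (ℚₚ.*-distribˡ-+ c (f 0 t) _))

Σ<-shift : ∀ K (f : ℕ → Poly) → Σ< K (shift ∘ f) ≈ₚ shift (Σ< K f)
Σ<-shift zero    f zero    = refl
Σ<-shift zero    f (suc t) = refl
Σ<-shift (suc K) f zero    = trans (cong (0ℚ ℚ.+_) (Σ<-shift K (f ∘ suc) zero)) (ℚₚ.+-identityʳ 0ℚ)
Σ<-shift (suc K) f (suc t) = cong (f 0 t ℚ.+_) (Σ<-shift K (f ∘ suc) (suc t))

Σ<-shiftBy : ∀ i K (f : ℕ → Poly) → Σ< K (shiftBy i ∘ f) ≈ₚ shiftBy i (Σ< K f)
Σ<-shiftBy zero    K f = ≈ₚ-refl
Σ<-shiftBy (suc i) K f = ≈ₚ-trans (Σ<-shift K (shiftBy i ∘ f)) (shift-cong (Σ<-shiftBy i K f))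

Σ<-snoc : ∀ K (f : ℕ → Poly) → Σ< (suc K) f ≈ₚ Σ< K f +ₚ f K
Σ<-snoc zero    f t = trans (ℚₚ.+-identityʳ (f 0 t)) (sym (ℚₚ.+-identityˡ (f 0 t)))
Σ<-snoc (suc K) f t = trans (cong (f 0 t ℚ.+_) (Σ<-snoc K (f ∘ suc) t))
                            (sym (ℚₚ.+-assoc (f 0 t) (Σ< K (f ∘ suc) t) (f (suc K) t)))

VanishesFrom : ℕ → (ℕ → Poly) → Set
VanishesFrom K f = ∀ k → K ≤ k → f k ≈ₚ zeroₚ

Σ<-beyond : ∀ K d (f : ℕ → Poly) → VanishesFrom K f → Σ< (d + K) f ≈ₚ Σ< K f
Σ<-beyond K zero    f z = ≈ₚ-refl
Σ<-beyond K (suc d) f z = begin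
  Σ< (suc (d + K)) f          ≈⟨ Σ<-snoc (d + K) f ⟩
  Σ< (d + K) f +ₚ f (d + K)   ≈⟨ +ₚ-cong (Σ<-beyond K d f z) (z (d + K) (ℕₚ.m≤n+m K d)) ⟩
  Σ< K f +ₚ zeroₚ             ≈⟨ +ₚ-identityʳ (Σ< K f) ⟩
  Σ< K f                      ∎
  where open ≈ₚ-Reasoning

Σ<-extend : ∀ {K K′} (f : ℕ → Poly) → VanishesFrom K f → K ≤ K′ → Σ< K′ f ≈ₚ Σ< K f
Σ<-extend {K} {K′} f z K≤K′ t =
  trans (cong (λ x → Σ< x f t) (sym (ℕₚ.m∸n+n≡m K≤K′))) (Σ<-beyond K (K′ ∸ K) f z t)

Σ<-bounds : ∀ K K′ (f : ℕ → Poly) → VanishesFrom K f → VanishesFrom K′ f → Σ< K f ≈ₚ Σ< K′ f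
Σ<-bounds K K′ f z z′ with ℕₚ.≤-total K K′
... | inj₁ K≤K′ = ≈ₚ-sym (Σ<-extend f z K≤K′)
... | inj₂ K′≤K = Σ<-extend f z′ K′≤K

Σ<-dropLeading : ∀ j K (f : ℕ → Poly) → (∀ i → i < j → f i ≈ₚ zeroₚ) →
                 Σ< (j + K) f ≈ₚ Σ< K (λ k → f (j + k))
Σ<-dropLeading zero    K f z = ≈ₚ-refl
Σ<-dropLeading (suc j) K f z t =
  trans (cong₂ ℚ._+_ (z 0 (s≤s z≤n) t) (Σ<-dropLeading j K (f ∘ suc) (λ i i<j → z (suc i) (s≤s i<j)) t))
        (ℚₚ.+-identityˡ _)

sumFinₚ-cong : ∀ {M} {f g : Fin M → Poly} → (∀ i → f i ≈ₚ g i) → sumFinₚ f ≈ₚ sumFinₚ g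
sumFinₚ-cong {zero}  e = ≈ₚ-refl
sumFinₚ-cong {suc M} e = +ₚ-cong (e Fin.zero) (sumFinₚ-cong (e ∘ Fin.suc))

sumFinₚ≈Σ< : ∀ M (g : ℕ → Poly) → sumFinₚ {M} (λ i → g (toℕ i)) ≈ₚ Σ< M g
sumFinₚ≈Σ< zero    g = ≈ₚ-refl
sumFinₚ≈Σ< (suc M) g = +ₚ-cong {p = g 0} ≈ₚ-refl (sumFinₚ≈Σ< M (g ∘ suc))

ι : ℕ → ℚ
ι x = + x ℚ./ 1

-- (closed computations with ℚ normalise through gcd, so they are done once here)
ι-0 : ι 0 ≡ 0ℚ
ι-0 = refl

ι-1 : ι 1 ≡ 1ℚ
ι-1 = refl

ι-+ : ∀ x y → ι (x + y) ≡ ι x ℚ.+ ι y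
ι-+ x y = ℚₚ.toℚᵘ-injective (ℚᵘₚ.≃-trans (ℚᵘₚ.≃-trans (ℚₚ.toℚᵘ-fromℚᵘ (ℚᵘ.mkℚᵘ (+ (x + y)) 0))
  (ℚᵘ.*≡* cross)) (ℚᵘₚ.≃-sym (ℚᵘₚ.≃-trans (ℚₚ.toℚᵘ-homo-+ (ι x) (ι y))
    (ℚᵘₚ.+-cong (ℚₚ.toℚᵘ-fromℚᵘ (ℚᵘ.mkℚᵘ (+ x) 0)) (ℚₚ.toℚᵘ-fromℚᵘ (ℚᵘ.mkℚᵘ (+ y) 0))))))
  where
  distrib : ∀ (a b : ℤ.ℤ) → (a ℤ.+ b) ℤ.* (+ 1 ℤ.* + 1) ≡ (a ℤ.* + 1 ℤ.+ b ℤ.* + 1) ℤ.* + 1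
  distrib = ℤSolver.solve-∀
  cross : + (x + y) ℤ.* (+ 1 ℤ.* + 1) ≡ (+ x ℤ.* + 1 ℤ.+ + y ℤ.* + 1) ℤ.* + 1
  cross = trans (cong (ℤ._* (+ 1 ℤ.* + 1)) (ℤₚ.pos-+ x y)) (distrib (+ x) (+ y))

frac-* : ∀ a d x y → a * x ≡ suc d * y → frac (+ a) (suc d) ℚ.* ι x ≡ ι y
frac-* a d x y e = ℚₚ.toℚᵘ-injective (ℚᵘₚ.≃-trans (ℚₚ.toℚᵘ-homo-* (frac (+ a) (suc d)) (ι x))
  (ℚᵘₚ.≃-trans (ℚᵘₚ.*-cong (ℚₚ.toℚᵘ-fromℚᵘ (ℚᵘ.mkℚᵘ (+ a) d)) (ℚₚ.toℚᵘ-fromℚᵘ (ℚᵘ.mkℚᵘ (+ x) 0)))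
   (ℚᵘₚ.≃-trans (ℚᵘ.*≡* cross) (ℚᵘₚ.≃-sym (ℚₚ.toℚᵘ-fromℚᵘ (ℚᵘ.mkℚᵘ (+ y) 0))))))
  where
  cross : (+ a ℤ.* + x) ℤ.* + 1 ≡ + y ℤ.* + (suc d * 1)
  cross = begin
    (+ a ℤ.* + x) ℤ.* + 1   ≡⟨ ℤₚ.*-identityʳ (+ a ℤ.* + x) ⟩
    + a ℤ.* + x             ≡⟨ ℤₚ.pos-* a x ⟨
    + (a * x)               ≡⟨ cong +_ (trans e (ℕₚ.*-comm (suc d) y)) ⟩
    + (y * suc d)           ≡⟨ cong (λ z → + (y * z)) (ℕₚ.*-identityʳ (suc d)) ⟨
    + (y * (suc d * 1))     ≡⟨ ℤₚ.pos-* y (suc d * 1) ⟩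
    + y ℤ.* + (suc d * 1)   ∎
    where open ≡-Reasoning

pascal : ∀ n k → suc n C suc k ≡ n C suc k + n C k
pascal n k = trans (sym (nCk+nC[k+1]≡[n+1]C[k+1] n k)) (ℕₚ.+-comm (n C k) (n C suc k))

pascal-∸ : ∀ m k → (suc m ∸ k) C suc k ≡ (m ∸ k) C suc k + (m ∸ k) C k
pascal-∸ m k with ℕₚ.≤-total k m
... | inj₁ k≤m rewrite ℕₚ.+-∸-assoc 1 k≤m = pascal (m ∸ k) k
pascal-∸ m zero    | inj₂ m≤0 rewrite ℕₚ.n≤0⇒n≡0 m≤0 = refl
pascal-∸ m (suc k) | inj₂ m≤k rewrite ℕₚ.m≤n⇒m∸n≡0 m≤k =
  k>n⇒nCk≡0 (s≤s (ℕₚ.≤-trans (ℕₚ.m∸n≤m m k) m≤k))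

absorption : ∀ b k → suc k * (suc b C suc k) ≡ suc b * (b C k)
absorption zero    zero    = refl
absorption zero    (suc k) = ℕₚ.*-zeroʳ (suc (suc k))
absorption (suc b) zero    = trans (ℕₚ.*-identityˡ (suc (suc b) C 1))
                                   (trans (nC1≡n (suc (suc b))) (sym (ℕₚ.*-identityʳ (suc (suc b)))))
absorption (suc b) (suc k) = begin
  suc (suc k) * (suc (suc b) C suc (suc k))   ≡⟨ cong (suc (suc k) *_) (nCk+nC[k+1]≡[n+1]C[k+1] (suc b) (suc k)) ⟨
  suc (suc k) * (X + Y)                        ≡⟨ ℕₚ.*-distribˡ-+ (suc (suc k)) X Y ⟩
  (X + suc k * X) + suc (suc k) * Y            ≡⟨ cong₂ _+_ (cong (λ z → X + z) (absorption b k)) (absorption b (suc k)) ⟩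
  (X + suc b * (b C k)) + suc b * (b C suc k)  ≡⟨ regroup X (b C k) (b C suc k) b ⟩
  X + suc b * (b C k + b C suc k)              ≡⟨ cong (λ z → X + suc b * z) (nCk+nC[k+1]≡[n+1]C[k+1] b k) ⟩
  suc (suc b) * X                              ∎
  where
  X = suc b C suc k
  Y = suc b C suc (suc k)
  regroup : ∀ x p r b → (x + suc b * p) + suc b * r ≡ x + suc b * (p + r)
  regroup = ℕSolver.solve-∀
  open ≡-Reasoning

C-vanish : ∀ m k → m < 2 * k → (m ∸ k) C k ≡ 0
C-vanish m zero    ()
C-vanish m (suc k) m<2k = k>n⇒nCk≡0 (subst (m ∸ suc k <_) (ℕₚ.+-identityʳ (suc k))
                                      (ℕₚ.m<n+o⇒m∸n<o m (suc k) {suc k + 0} m<2k))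

-- The coefficient families.  A family c : ℕ → ℕ → ℚ stands for the
-- polynomials  Σ_k c m k · q^k (1+q)^(m-2k),  m = 0, 1, 2, ...
Coeffs : Set
Coeffs = ℕ → ℕ → ℚ

sign : ℕ → ℚ
sign k = (ℚ.- 1ℚ) ^ℚ k

chebCoeff : Coeffs
chebCoeff m k = sign k ℚ.* ι ((m ∸ k) C k)

-- Lucas coefficients  (-1)^k m/(m-k) C(m-k,k); cFormula n (j+k) j is lucasCoeff (n-2j) k
lucasCoeff : Coeffs
lucasCoeff m k = (sign k ℚ.* frac (+ m) (m ∸ k)) ℚ.* ι ((m ∸ k) C k)

chebCoeff-vanish : ∀ m k → m < 2 * k → chebCoeff m k ≡ 0ℚ
chebCoeff-vanish m k m<2k = trans (cong (λ z → sign k ℚ.* ι z) (C-vanish m k m<2k)) (ℚₚ.*-zeroʳ (sign k))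

lucasCoeff-vanish : ∀ m k → m < 2 * k → lucasCoeff m k ≡ 0ℚ
lucasCoeff-vanish m k m<2k = trans (cong (λ z → (sign k ℚ.* frac (+ m) (m ∸ k)) ℚ.* ι z) (C-vanish m k m<2k))
                                   (ℚₚ.*-zeroʳ (sign k ℚ.* frac (+ m) (m ∸ k)))

lucasCoeff-zero : ∀ m → lucasCoeff (suc m) 0 ≡ 1ℚ
lucasCoeff-zero m = begin
  (1ℚ ℚ.* frac (+ suc m) (suc m)) ℚ.* ι 1   ≡⟨ cong (ℚ._* ι 1) (ℚₚ.*-identityˡ (frac (+ suc m) (suc m))) ⟩
  frac (+ suc m) (suc m) ℚ.* ι 1            ≡⟨ frac-* (suc m) m 1 1 refl ⟩
  ι 1                                       ≡⟨ ι-1 ⟩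
  1ℚ                                        ∎
  where open ≡-Reasoning

chebCoeff-zero : ∀ m → chebCoeff m 0 ≡ 1ℚ
chebCoeff-zero m = trans (ℚₚ.*-identityˡ (ι 1)) ι-1

sign-split : ∀ k x y → sign (suc k) ℚ.* ι (x + y) ≡ sign (suc k) ℚ.* ι x ℚ.+ (ℚ.- 1ℚ) ℚ.* (sign k ℚ.* ι y)
sign-split k x y = begin
  sign (suc k) ℚ.* ι (x + y)                                ≡⟨ cong (sign (suc k) ℚ.*_) (ι-+ x y) ⟩
  sign (suc k) ℚ.* (ι x ℚ.+ ι y)                            ≡⟨ ℚₚ.*-distribˡ-+ (sign (suc k)) (ι x) (ι y) ⟩
  sign (suc k) ℚ.* ι x ℚ.+ sign (suc k) ℚ.* ι y             ≡⟨ cong (sign (suc k) ℚ.* ι x ℚ.+_) (ℚₚ.*-assoc (ℚ.- 1ℚ) (sign k) (ι y)) ⟩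
  sign (suc k) ℚ.* ι x ℚ.+ (ℚ.- 1ℚ) ℚ.* (sign k ℚ.* ι y)   ∎
  where open ≡-Reasoning

-- Pascal's rule makes chebCoeff satisfy the Chebyshev recurrence
chebCoeff-recurrence : ∀ m k →
  chebCoeff (suc (suc m)) (suc k) ≡ chebCoeff (suc m) (suc k) ℚ.+ (ℚ.- 1ℚ) ℚ.* chebCoeff m k
chebCoeff-recurrence m k =
  trans (cong (λ z → sign (suc k) ℚ.* ι z) (pascal-∸ m k)) (sign-split k ((m ∸ k) C suc k) ((m ∸ k) C k))

-- (m+2)/(m+1-k) · C(m+1-k,k+1) = C(m+1-k,k+1) + C(m-k,k), by absorption
LucasFactor : ℕ → ℕ → Set
LucasFactor m k = frac (+ suc (suc m)) (suc m ∸ k) ℚ.* ι ((suc m ∸ k) C suc k)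
                  ≡ ι ((suc m ∸ k) C suc k + (m ∸ k) C k)

lucasFactor-inside : ∀ m k → k ≤ m → LucasFactor m k
lucasFactor-inside m k k≤m =
  subst (λ t → frac (+ suc (suc m)) t ℚ.* ι (t C suc k) ≡ ι (t C suc k + b C k))
        (sym (ℕₚ.+-∸-assoc 1 k≤m)) (frac-* (suc (suc m)) b x (x + P) numerators)
  where
  b = m ∸ k
  x = suc b C suc k
  P = b C k
  m+2≡ : suc (suc m) ≡ suc b + suc k
  m+2≡ = cong suc (trans (cong suc (sym (ℕₚ.m∸n+n≡m k≤m))) (sym (ℕₚ.+-suc b k)))
  numerators : suc (suc m) * x ≡ suc b * (x + P)
  numerators = begin
    suc (suc m) * x             ≡⟨ cong (_* x) m+2≡ ⟩
    (suc b + suc k) * x         ≡⟨ ℕₚ.*-distribʳ-+ x (suc b) (suc k) ⟩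
    suc b * x + suc k * x       ≡⟨ cong (λ z → suc b * x + z) (absorption b k) ⟩
    suc b * x + suc b * P       ≡⟨ ℕₚ.*-distribˡ-+ (suc b) x P ⟨
    suc b * (x + P)             ∎
    where open ≡-Reasoning

-- past the range both sides are 0
lucasFactor-outside : ∀ m k → m < k → LucasFactor m k
lucasFactor-outside m (suc k) (s≤s m≤k) =
  subst (λ t → frac (+ suc (suc m)) t ℚ.* ι (t C suc (suc k)) ≡ ι (t C suc (suc k) + (m ∸ suc k) C suc k))
        (sym (ℕₚ.m≤n⇒m∸n≡0 m≤k))
        (subst (λ t → 0ℚ ℚ.* ι 0 ≡ ι (t C suc k)) (sym (ℕₚ.m≤n⇒m∸n≡0 (ℕₚ.m≤n⇒m≤1+n m≤k)))
               (trans (ℚₚ.*-zeroˡ (ι 0)) (sym ι-0)))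

lucasFactor : ∀ m k → LucasFactor m k
lucasFactor m k = by-cases (k ℕ.≤? m)
  where
  by-cases : Dec (k ≤ m) → LucasFactor m k
  by-cases (yes k≤m) = lucasFactor-inside m k k≤m
  by-cases (no k≰m)  = lucasFactor-outside m k (ℕₚ.≰⇒> k≰m)

lucasCoeff-split : ∀ m k →
  lucasCoeff (suc (suc m)) (suc k) ≡ chebCoeff (suc (suc m)) (suc k) ℚ.+ (ℚ.- 1ℚ) ℚ.* chebCoeff m k
lucasCoeff-split m k = begin
  (sign (suc k) ℚ.* f) ℚ.* ι X               ≡⟨ ℚₚ.*-assoc (sign (suc k)) f (ι X) ⟩
  sign (suc k) ℚ.* (f ℚ.* ι X)               ≡⟨ cong (sign (suc k) ℚ.*_) (lucasFactor m k) ⟩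
  sign (suc k) ℚ.* ι (X + (m ∸ k) C k)       ≡⟨ sign-split k X ((m ∸ k) C k) ⟩
  chebCoeff (suc (suc m)) (suc k) ℚ.+ (ℚ.- 1ℚ) ℚ.* chebCoeff m k ∎
  where
  f = frac (+ suc (suc m)) (suc m ∸ k)
  X = (suc m ∸ k) C suc k
  open ≡-Reasoning

term : Coeffs → ℕ → ℕ → Poly
term c m k = c m k ·ₚ shiftBy k (onePlusQ^ (m ∸ 2 * k))

expansion : Coeffs → ℕ → Poly
expansion c m = Σ< (suc m) (term c m)

Supported : Coeffs → Set
Supported c = ∀ m k → m < 2 * k → c m k ≡ 0ℚ

term-vanish : ∀ c m k → c m k ≡ 0ℚ → term c m k ≈ₚ zeroₚ
term-vanish c m k = ·ₚ-vanish (shiftBy k (onePlusQ^ (m ∸ 2 * k)))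

term-support : ∀ {c} → Supported c → ∀ m K → m < 2 * K → VanishesFrom K (term c m)
term-support {c} sup m K m<2K k K≤k = term-vanish c m k (sup m k (ℕₚ.<-≤-trans m<2K (ℕₚ.*-monoʳ-≤ 2 K≤k)))

term-support-top : ∀ {c} → Supported c → ∀ m → VanishesFrom (suc m) (term c m)
term-support-top sup m = term-support sup m (suc m) (ℕₚ.<-≤-trans (ℕₚ.n<1+n m) (ℕₚ.m≤n*m (suc m) 2))

exponent-step : ∀ m k → suc (suc m) ∸ 2 * suc k ≡ m ∸ 2 * k
exponent-step m k = cong (suc m ∸_) (ℕₚ.+-suc k (k + 0))

exponent-odd : ∀ m k → suc m ∸ 2 * suc k ≡ m ∸ suc (2 * k)
exponent-odd m k = cong (m ∸_) (ℕₚ.+-suc k (k + 0))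

onePlusQ-times : ∀ i a → shiftBy i (onePlusQ^ a) +ₚ shift (shiftBy i (onePlusQ^ a)) ≈ₚ shiftBy i (onePlusQ^ (suc a))
onePlusQ-times i a t = trans (cong (λ p → shiftBy i (onePlusQ^ a) t ℚ.+ p t) (shift-shiftBy i (onePlusQ^ a)))
                             (sym (shiftBy-+ₚ i (onePlusQ^ a) (shift (onePlusQ^ a)) t))

onePlusQ-step : ∀ m k → suc (2 * k) ≤ m →
  shiftBy (suc k) (onePlusQ^ (suc m ∸ 2 * suc k)) +ₚ shift (shiftBy (suc k) (onePlusQ^ (suc m ∸ 2 * suc k)))
  ≈ₚ shiftBy (suc k) (onePlusQ^ (m ∸ 2 * k))
onePlusQ-step m k 2k<m rewrite exponent-odd m k =
  ≈ₚ-trans (onePlusQ-times (suc k) (m ∸ suc (2 * k)))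
           (λ t → cong (λ z → shiftBy (suc k) (onePlusQ^ z) t) (sym (ℕₚ.+-∸-assoc 1 2k<m)))

-- Coefficients satisfying  c(m+2, k) = c(m+1, k) - c(m, k-1)  at level m
-- (with c(m, -1) read as 0) have expansions satisfying the recurrence
-- E(m+2) = (1+q) E(m+1) - q E(m) of Chebyshev polynomials.
ChebyshevRecurrence : Coeffs → ℕ → Set
ChebyshevRecurrence c m =
  c (suc (suc m)) 0 ≡ c (suc m) 0 ×
  (∀ k → c (suc (suc m)) (suc k) ≡ c (suc m) (suc k) ℚ.+ (ℚ.- 1ℚ) ℚ.* c m k)

-- the summands of q · E(m), placed at the positions they occupy in level m+2
lowered : Coeffs → ℕ → ℕ → Poly
lowered c m zero    = zeroₚ
lowered c m (suc k) = shift (term c m k)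

Σ<-lowered : ∀ {c} → Supported c → ∀ m → Σ< (suc (suc (suc m))) (lowered c m) ≈ₚ shift (expansion c m)
Σ<-lowered {c} sup m = begin
  zeroₚ +ₚ Σ< (suc (suc m)) (shift ∘ term c m)   ≈⟨ +ₚ-identityˡ _ ⟩
  Σ< (suc (suc m)) (shift ∘ term c m)            ≈⟨ Σ<-shift (suc (suc m)) (term c m) ⟩
  shift (Σ< (suc (suc m)) (term c m))            ≈⟨ shift-cong (Σ<-extend (term c m) (term-support-top sup m) (ℕₚ.n≤1+n _)) ⟩
  shift (expansion c m)                          ∎
  where open ≈ₚ-Reasoning

lowered-suc : ∀ c m k → (ℚ.- 1ℚ) ·ₚ lowered c m (suc k) ≈ₚ
                        ((ℚ.- 1ℚ) ℚ.* c m k) ·ₚ shiftBy (suc k) (onePlusQ^ (m ∸ 2 * k))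
lowered-suc c m k = ≈ₚ-trans (·ₚ-congʳ (ℚ.- 1ℚ) (shift-·ₚ (c m k) P)) (·ₚ-assoc (ℚ.- 1ℚ) (c m k) (shift P))
  where P = shiftBy k (onePlusQ^ (m ∸ 2 * k))

odd-bound : ∀ m k → m < suc (2 * k) → suc m < 2 * suc k
odd-bound m k m<2k+1 = subst (suc m <_) (cong suc (sym (ℕₚ.+-suc k (k + 0)))) (s≤s m<2k+1)

term-recurrence : ∀ {c} → Supported c → ∀ {m} → ChebyshevRecurrence c m → ∀ k →
  term c (suc (suc m)) k ≈ₚ
    (term c (suc m) k +ₚ shift (term c (suc m) k)) +ₚ (ℚ.- 1ℚ) ·ₚ lowered c m k
term-recurrence {c} sup {m} (rec₀ , _) zero = begin
  c₂ ·ₚ (X +ₚ shift X)                      ≈⟨ ·ₚ-congˡ (X +ₚ shift X) rec₀ ⟩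
  c₁ ·ₚ (X +ₚ shift X)                      ≈⟨ ·ₚ-distribˡ c₁ X (shift X) ⟩
  c₁ ·ₚ X +ₚ c₁ ·ₚ shift X                  ≈⟨ +ₚ-cong {p = c₁ ·ₚ X} ≈ₚ-refl (≈ₚ-sym (shift-·ₚ c₁ X)) ⟩
  c₁ ·ₚ X +ₚ shift (c₁ ·ₚ X)                ≈⟨ ≈ₚ-sym (+ₚ-identityʳ _) ⟩
  (c₁ ·ₚ X +ₚ shift (c₁ ·ₚ X)) +ₚ zeroₚ     ≈⟨ +ₚ-cong {p = c₁ ·ₚ X +ₚ shift (c₁ ·ₚ X)} ≈ₚ-refl (≈ₚ-sym (·ₚ-zeroʳ (ℚ.- 1ℚ))) ⟩
  (c₁ ·ₚ X +ₚ shift (c₁ ·ₚ X)) +ₚ (ℚ.- 1ℚ) ·ₚ zeroₚ ∎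
  where
  c₂ = c (suc (suc m)) 0
  c₁ = c (suc m) 0
  X = onePlusQ^ (suc m)
  open ≈ₚ-Reasoning
term-recurrence {c} sup {m} (_ , rec) (suc k) = begin
  c₂ ·ₚ shiftBy (suc k) (onePlusQ^ (suc (suc m) ∸ 2 * suc k))
      ≈⟨ ·ₚ-congʳ c₂ (λ t → cong (λ z → shiftBy (suc k) (onePlusQ^ z) t) (exponent-step m k)) ⟩
  c₂ ·ₚ Y                                   ≈⟨ ·ₚ-congˡ Y (rec k) ⟩
  (c₁ ℚ.+ (ℚ.- 1ℚ) ℚ.* c₀) ·ₚ Y             ≈⟨ ·ₚ-distribʳ c₁ _ Y ⟩
  c₁ ·ₚ Y +ₚ ((ℚ.- 1ℚ) ℚ.* c₀) ·ₚ Y         ≈⟨ +ₚ-cong (≈ₚ-sym upper) (≈ₚ-sym (lowered-suc c m k)) ⟩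
  (term c (suc m) (suc k) +ₚ shift (term c (suc m) (suc k))) +ₚ (ℚ.- 1ℚ) ·ₚ lowered c m (suc k) ∎
  where
  open ≈ₚ-Reasoning
  c₂ = c (suc (suc m)) (suc k)
  c₁ = c (suc m) (suc k)
  c₀ = c m k
  Y = shiftBy (suc k) (onePlusQ^ (m ∸ 2 * k))
  Z = shiftBy (suc k) (onePlusQ^ (suc m ∸ 2 * suc k))
  -- (1+q) times the level-(m+1) summand; when that summand is cut off, c₁ = 0
  times-onePlusQ : c₁ ·ₚ (Z +ₚ shift Z) ≈ₚ c₁ ·ₚ Y
  times-onePlusQ with suc (2 * k) ℕ.≤? m
  ... | yes 2k<m = ·ₚ-congʳ c₁ (onePlusQ-step m k 2k<m)
  ... | no 2k≮m = ≈ₚ-trans (·ₚ-vanish (Z +ₚ shift Z) c₁≡0) (≈ₚ-sym (·ₚ-vanish Y c₁≡0))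
    where
    c₁≡0 : c₁ ≡ 0ℚ
    c₁≡0 = sup (suc m) (suc k) (odd-bound m k (ℕₚ.≰⇒> 2k≮m))
  upper : term c (suc m) (suc k) +ₚ shift (term c (suc m) (suc k)) ≈ₚ c₁ ·ₚ Y
  upper = begin
    c₁ ·ₚ Z +ₚ shift (c₁ ·ₚ Z)      ≈⟨ +ₚ-cong {p = c₁ ·ₚ Z} ≈ₚ-refl (shift-·ₚ c₁ Z) ⟩
    c₁ ·ₚ Z +ₚ c₁ ·ₚ shift Z        ≈⟨ ≈ₚ-sym (·ₚ-distribˡ c₁ Z (shift Z)) ⟩
    c₁ ·ₚ (Z +ₚ shift Z)            ≈⟨ times-onePlusQ ⟩
    c₁ ·ₚ Y                         ∎

expansion-recurrence : ∀ {c} → Supported c → ∀ {m} → ChebyshevRecurrence c m →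
  expansion c (suc (suc m)) ≈ₚ
    (expansion c (suc m) +ₚ shift (expansion c (suc m))) +ₚ (ℚ.- 1ℚ) ·ₚ shift (expansion c m)
expansion-recurrence {c} sup {m} rec = begin
  Σ< K (term c (suc (suc m)))                          ≈⟨ Σ<-cong K (term-recurrence sup rec) ⟩
  Σ< K (λ k → (E₁ k +ₚ shift (E₁ k)) +ₚ (ℚ.- 1ℚ) ·ₚ lowered c m k)
      ≈⟨ ≈ₚ-trans (Σ<-+ₚ K (λ k → E₁ k +ₚ shift (E₁ k)) (λ k → (ℚ.- 1ℚ) ·ₚ lowered c m k)) (+ₚ-cong (Σ<-+ₚ K E₁ (shift ∘ E₁)) (Σ<-·ₚ K (ℚ.- 1ℚ) (lowered c m))) ⟩
  (Σ< K E₁ +ₚ Σ< K (shift ∘ E₁)) +ₚ (ℚ.- 1ℚ) ·ₚ Σ< K (lowered c m)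
      ≈⟨ +ₚ-cong (+ₚ-cong level₁ (≈ₚ-trans (Σ<-shift K E₁) (shift-cong level₁)))
                 (·ₚ-congʳ (ℚ.- 1ℚ) (Σ<-lowered sup m)) ⟩
  (expansion c (suc m) +ₚ shift (expansion c (suc m))) +ₚ (ℚ.- 1ℚ) ·ₚ shift (expansion c m) ∎
  where
  K = suc (suc (suc m))
  E₁ = term c (suc m)
  level₁ : Σ< K E₁ ≈ₚ expansion c (suc m)
  level₁ = Σ<-extend E₁ (term-support-top sup (suc m)) (ℕₚ.n≤1+n _)
  open ≈ₚ-Reasoning

expansion-zero : ∀ c → c 0 0 ≡ 1ℚ → expansion c 0 ≈ₚ oneₚ
expansion-zero c c₀₀≡1 =
  ≈ₚ-trans (+ₚ-identityʳ (term c 0 0)) (≈ₚ-trans (·ₚ-congˡ oneₚ c₀₀≡1) (·ₚ-identityˡ oneₚ))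

expansion-one : ∀ {c} → Supported c → c 1 0 ≡ 1ℚ → expansion c 1 ≈ₚ oneₚ +ₚ shift oneₚ
expansion-one {c} sup c₁₀≡1 = begin
  Σ< 2 (term c 1)                 ≈⟨ Σ<-extend (term c 1) (term-support sup 1 1 (s≤s (s≤s z≤n))) (ℕₚ.n≤1+n 1) ⟩
  term c 1 0 +ₚ zeroₚ             ≈⟨ +ₚ-identityʳ (term c 1 0) ⟩
  c 1 0 ·ₚ onePlusQ^ 1            ≈⟨ ·ₚ-congˡ (onePlusQ^ 1) c₁₀≡1 ⟩
  1ℚ ·ₚ onePlusQ^ 1               ≈⟨ ·ₚ-identityˡ (onePlusQ^ 1) ⟩
  oneₚ +ₚ shift oneₚ              ∎
  where open ≈ₚ-Reasoning

geometric : ℕ → Poly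
geometric m = Σ< (suc m) (λ k → shiftBy k oneₚ)

geometric-snoc : ∀ m → geometric (suc m) ≈ₚ geometric m +ₚ shiftBy (suc m) oneₚ
geometric-snoc m = Σ<-snoc (suc m) (λ k → shiftBy k oneₚ)

geometric-uncons : ∀ m → geometric (suc m) ≈ₚ oneₚ +ₚ shift (geometric m)
geometric-uncons m = +ₚ-cong {p = oneₚ} ≈ₚ-refl (Σ<-shift (suc m) (λ k → shiftBy k oneₚ))

shift-geometric-snoc : ∀ m → shift (geometric (suc m)) ≈ₚ shift (geometric m) +ₚ shiftBy (suc (suc m)) oneₚ
shift-geometric-snoc m = ≈ₚ-trans (shift-cong (geometric-snoc m)) (shift-+ₚ (geometric m) _)

cancel-middle : ∀ (a b c : ℚ) → (a ℚ.+ (b ℚ.+ c)) ℚ.+ (ℚ.- 1ℚ) ℚ.* b ≡ a ℚ.+ c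
cancel-middle = solve-∀ ℚ-ring

geometric-recurrence : ∀ m →
  (geometric (suc m) +ₚ shift (geometric (suc m))) +ₚ (ℚ.- 1ℚ) ·ₚ shift (geometric m) ≈ₚ geometric (suc (suc m))
geometric-recurrence m t = begin
  (G₁ t ℚ.+ shift G₁ t) ℚ.+ (ℚ.- 1ℚ) ℚ.* shift G₀ t
      ≡⟨ cong (λ z → (G₁ t ℚ.+ z) ℚ.+ (ℚ.- 1ℚ) ℚ.* shift G₀ t) (shift-geometric-snoc m t) ⟩
  (G₁ t ℚ.+ (shift G₀ t ℚ.+ qᵐ t)) ℚ.+ (ℚ.- 1ℚ) ℚ.* shift G₀ t
      ≡⟨ cancel-middle (G₁ t) (shift G₀ t) (qᵐ t) ⟩
  G₁ t ℚ.+ qᵐ t                                                  ≡⟨ geometric-snoc (suc m) t ⟨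
  geometric (suc (suc m)) t                                      ∎
  where
  G₀ = geometric m
  G₁ = geometric (suc m)
  qᵐ = shiftBy (suc (suc m)) oneₚ
  open ≡-Reasoning

geometric-telescope : ∀ m →
  geometric (suc (suc m)) +ₚ (ℚ.- 1ℚ) ·ₚ shift (geometric m) ≈ₚ oneₚ +ₚ shiftBy (suc (suc m)) oneₚ
geometric-telescope m t = begin
  G₂ t ℚ.+ (ℚ.- 1ℚ) ℚ.* shift G₀ t
      ≡⟨ cong (ℚ._+ (ℚ.- 1ℚ) ℚ.* shift G₀ t) (geometric-uncons (suc m) t) ⟩
  (oneₚ t ℚ.+ shift (geometric (suc m)) t) ℚ.+ (ℚ.- 1ℚ) ℚ.* shift G₀ t
      ≡⟨ cong (λ z → (oneₚ t ℚ.+ z) ℚ.+ (ℚ.- 1ℚ) ℚ.* shift G₀ t) (shift-geometric-snoc m t) ⟩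
  (oneₚ t ℚ.+ (shift G₀ t ℚ.+ qᵐ t)) ℚ.+ (ℚ.- 1ℚ) ℚ.* shift G₀ t
      ≡⟨ cancel-middle (oneₚ t) (shift G₀ t) (qᵐ t) ⟩
  oneₚ t ℚ.+ qᵐ t ∎
  where
  G₀ = geometric m
  G₂ = geometric (suc (suc m))
  qᵐ = shiftBy (suc (suc m)) oneₚ
  open ≡-Reasoning

chebyshev-step : ∀ m → expansion chebCoeff m ≈ₚ geometric m → expansion chebCoeff (suc m) ≈ₚ geometric (suc m) →
                 expansion chebCoeff (suc (suc m)) ≈ₚ geometric (suc (suc m))
chebyshev-step m E₀≈G₀ E₁≈G₁ = begin
  expansion chebCoeff (suc (suc m))
      ≈⟨ expansion-recurrence chebCoeff-vanish (level-zero , chebCoeff-recurrence m) ⟩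
  (expansion chebCoeff (suc m) +ₚ shift (expansion chebCoeff (suc m))) +ₚ (ℚ.- 1ℚ) ·ₚ shift (expansion chebCoeff m)
      ≈⟨ +ₚ-cong (+ₚ-cong E₁≈G₁ (shift-cong E₁≈G₁)) (·ₚ-congʳ (ℚ.- 1ℚ) (shift-cong E₀≈G₀)) ⟩
  (geometric (suc m) +ₚ shift (geometric (suc m))) +ₚ (ℚ.- 1ℚ) ·ₚ shift (geometric m)
      ≈⟨ geometric-recurrence m ⟩
  geometric (suc (suc m)) ∎
  where
  open ≈ₚ-Reasoning
  level-zero : chebCoeff (suc (suc m)) 0 ≡ chebCoeff (suc m) 0
  level-zero = trans (chebCoeff-zero (suc (suc m))) (sym (chebCoeff-zero (suc m)))

chebyshev≈geometric : ∀ m → expansion chebCoeff m ≈ₚ geometric m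
chebyshev≈geometric m = proj₁ (consecutive m)
  where
  consecutive : ∀ m → (expansion chebCoeff m ≈ₚ geometric m) × (expansion chebCoeff (suc m) ≈ₚ geometric (suc m))
  consecutive zero =
      ≈ₚ-trans (expansion-zero chebCoeff (chebCoeff-zero 0)) (≈ₚ-sym (+ₚ-identityʳ oneₚ))
    , ≈ₚ-trans (expansion-one chebCoeff-vanish (chebCoeff-zero 1))
               (+ₚ-cong {p = oneₚ} ≈ₚ-refl (≈ₚ-sym (+ₚ-identityʳ (shift oneₚ))))
  consecutive (suc m) = proj₂ (consecutive m) , chebyshev-step m (proj₁ (consecutive m)) (proj₂ (consecutive m))

lucas≈chebyshev : ∀ m → expansion lucasCoeff (suc (suc m)) ≈ₚ
  expansion chebCoeff (suc (suc m)) +ₚ (ℚ.- 1ℚ) ·ₚ shift (expansion chebCoeff m)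
lucas≈chebyshev m = begin
  Σ< K (term lucasCoeff (suc (suc m)))
      ≈⟨ Σ<-cong K termwise ⟩
  Σ< K (λ k → term chebCoeff (suc (suc m)) k +ₚ (ℚ.- 1ℚ) ·ₚ lowered chebCoeff m k)
      ≈⟨ Σ<-+ₚ K (term chebCoeff (suc (suc m))) (λ k → (ℚ.- 1ℚ) ·ₚ lowered chebCoeff m k) ⟩
  expansion chebCoeff (suc (suc m)) +ₚ Σ< K (λ k → (ℚ.- 1ℚ) ·ₚ lowered chebCoeff m k)
      ≈⟨ +ₚ-cong {p = expansion chebCoeff (suc (suc m))} ≈ₚ-refl
           (≈ₚ-trans (Σ<-·ₚ K (ℚ.- 1ℚ) (lowered chebCoeff m)) (·ₚ-congʳ (ℚ.- 1ℚ) (Σ<-lowered chebCoeff-vanish m))) ⟩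
  expansion chebCoeff (suc (suc m)) +ₚ (ℚ.- 1ℚ) ·ₚ shift (expansion chebCoeff m) ∎
  where
  K = suc (suc (suc m))
  open ≈ₚ-Reasoning
  termwise : ∀ k → term lucasCoeff (suc (suc m)) k ≈ₚ term chebCoeff (suc (suc m)) k +ₚ (ℚ.- 1ℚ) ·ₚ lowered chebCoeff m k
  termwise zero = begin
    lucasCoeff (suc (suc m)) 0 ·ₚ X        ≈⟨ ·ₚ-congˡ X (trans (lucasCoeff-zero (suc m)) (sym (chebCoeff-zero (suc (suc m))))) ⟩
    chebCoeff (suc (suc m)) 0 ·ₚ X         ≈⟨ ≈ₚ-sym (+ₚ-identityʳ (chebCoeff (suc (suc m)) 0 ·ₚ X)) ⟩
    chebCoeff (suc (suc m)) 0 ·ₚ X +ₚ zeroₚ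
        ≈⟨ +ₚ-cong {p = chebCoeff (suc (suc m)) 0 ·ₚ X} ≈ₚ-refl (≈ₚ-sym (·ₚ-zeroʳ (ℚ.- 1ℚ))) ⟩
    chebCoeff (suc (suc m)) 0 ·ₚ X +ₚ (ℚ.- 1ℚ) ·ₚ zeroₚ ∎
    where X = onePlusQ^ (suc (suc m))
  termwise (suc k) = begin
    lucasCoeff (suc (suc m)) (suc k) ·ₚ Z   ≈⟨ ·ₚ-congˡ Z (lucasCoeff-split m k) ⟩
    (u₂ ℚ.+ (ℚ.- 1ℚ) ℚ.* u₀) ·ₚ Z           ≈⟨ ·ₚ-distribʳ u₂ ((ℚ.- 1ℚ) ℚ.* u₀) Z ⟩
    u₂ ·ₚ Z +ₚ ((ℚ.- 1ℚ) ℚ.* u₀) ·ₚ Z       ≈⟨ +ₚ-cong {p = u₂ ·ₚ Z} ≈ₚ-refl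
                                                 (≈ₚ-trans (·ₚ-congʳ ((ℚ.- 1ℚ) ℚ.* u₀) Z≈Y) (≈ₚ-sym (lowered-suc chebCoeff m k))) ⟩
    u₂ ·ₚ Z +ₚ (ℚ.- 1ℚ) ·ₚ lowered chebCoeff m (suc k) ∎
    where
    u₂ = chebCoeff (suc (suc m)) (suc k)
    u₀ = chebCoeff m k
    Z = shiftBy (suc k) (onePlusQ^ (suc (suc m) ∸ 2 * suc k))
    Z≈Y : Z ≈ₚ shiftBy (suc k) (onePlusQ^ (m ∸ 2 * k))
    Z≈Y t = cong (λ z → shiftBy (suc k) (onePlusQ^ z) t) (exponent-step m k)

S≈lucas : ∀ m → S (suc m) ≈ₚ expansion lucasCoeff (suc m)
S≈lucas zero    = ≈ₚ-trans (S-suc≈ 0) (≈ₚ-sym (expansion-one lucasCoeff-vanish (lucasCoeff-zero 0)))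
S≈lucas (suc m) = begin
  S (suc (suc m))                                                    ≈⟨ S-suc≈ (suc m) ⟩
  oneₚ +ₚ shiftBy (suc (suc m)) oneₚ                                 ≈⟨ ≈ₚ-sym (geometric-telescope m) ⟩
  geometric (suc (suc m)) +ₚ (ℚ.- 1ℚ) ·ₚ shift (geometric m)
      ≈⟨ ≈ₚ-sym (+ₚ-cong (chebyshev≈geometric (suc (suc m))) (·ₚ-congʳ (ℚ.- 1ℚ) (shift-cong (chebyshev≈geometric m)))) ⟩
  expansion chebCoeff (suc (suc m)) +ₚ (ℚ.- 1ℚ) ·ₚ shift (expansion chebCoeff m) ≈⟨ ≈ₚ-sym (lucas≈chebyshev m) ⟩
  expansion lucasCoeff (suc (suc m))                                 ∎
  where open ≈ₚ-Reasoning

-- The columns of M(B,S).  Column j, row j+k holds columnCoeff (n-2j) k: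
-- 1 on the diagonal and the Lucas coefficient below it.
columnCoeff : Coeffs
columnCoeff m zero    = 1ℚ
columnCoeff m (suc k) = lucasCoeff m (suc k)

columnCoeff-vanish : Supported columnCoeff
columnCoeff-vanish m zero    ()
columnCoeff-vanish m (suc k) = lucasCoeff-vanish m (suc k)

S-expansion : ∀ m K → m < 2 * K → S m ≈ₚ Σ< K (term columnCoeff m)
S-expansion zero K 0<2K = begin
  oneₚ                        ≈⟨ ≈ₚ-sym (expansion-zero columnCoeff refl) ⟩
  Σ< 1 (term columnCoeff 0)   ≈⟨ Σ<-bounds 1 K (term columnCoeff 0) (term-support-top columnCoeff-vanish 0)
                                              (term-support columnCoeff-vanish 0 K 0<2K) ⟩
  Σ< K (term columnCoeff 0)   ∎
  where open ≈ₚ-Reasoning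
S-expansion (suc m) K m<2K = begin
  S (suc m)                               ≈⟨ S≈lucas m ⟩
  expansion lucasCoeff (suc m)            ≈⟨ Σ<-bounds (suc (suc m)) K (term lucasCoeff (suc m))
                                               (term-support-top lucasCoeff-vanish (suc m))
                                               (term-support lucasCoeff-vanish (suc m) K m<2K) ⟩
  Σ< K (term lucasCoeff (suc m))          ≈⟨ Σ<-cong K diagonal-is-one ⟩
  Σ< K (term columnCoeff (suc m))         ∎
  where
  open ≈ₚ-Reasoning
  diagonal-is-one : ∀ k → term lucasCoeff (suc m) k ≈ₚ term columnCoeff (suc m) k
  diagonal-is-one zero    = ·ₚ-congˡ (onePlusQ^ (suc m)) (lucasCoeff-zero m)
  diagonal-is-one (suc k) = ≈ₚ-refl

Trichotomy : ℕ → ℕ → Set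
Trichotomy i j = Tri (i < j) (i ≡ j) (j < i)

entryByCase : ∀ n i j → Trichotomy i j → ℚ
entryByCase n i j (tri< _ _ _) = 0ℚ
entryByCase n i j (tri≈ _ _ _) = 1ℚ
entryByCase n i j (tri> _ _ _) = cFormula n i j

transitionEntry : ℕ → ℕ → ℕ → ℚ
transitionEntry n i j = entryByCase n i j (ℕₚ.<-cmp i j)

entry-above : ∀ n {i j} → i < j → transitionEntry n i j ≡ 0ℚ
entry-above n {i} {j} i<j = by-cases (ℕₚ.<-cmp i j)
  where
  by-cases : ∀ t → entryByCase n i j t ≡ 0ℚ
  by-cases (tri< _ _ _)   = refl
  by-cases (tri≈ i≮j _ _) = contradiction i<j i≮j
  by-cases (tri> i≮j _ _) = contradiction i<j i≮j

entry-diagonal : ∀ n j → transitionEntry n j j ≡ 1ℚ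
entry-diagonal n j = by-cases (ℕₚ.<-cmp j j)
  where
  by-cases : ∀ t → entryByCase n j j t ≡ 1ℚ
  by-cases (tri< _ j≢j _) = contradiction refl j≢j
  by-cases (tri≈ _ _ _)   = refl
  by-cases (tri> _ j≢j _) = contradiction refl j≢j

entry-below : ∀ n {i j} → j < i → transitionEntry n i j ≡ cFormula n i j
entry-below n {i} {j} j<i = by-cases (ℕₚ.<-cmp i j)
  where
  by-cases : ∀ t → entryByCase n i j t ≡ cFormula n i j
  by-cases (tri< _ _ j≮i) = contradiction j<i j≮i
  by-cases (tri≈ _ _ j≮i) = contradiction j<i j≮i
  by-cases (tri> _ _ _)   = refl

offset-top : ∀ n j k → n ∸ (j + k) ∸ j ≡ (n ∸ 2 * j) ∸ k
offset-top n j k = begin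
  n ∸ (j + k) ∸ j     ≡⟨ ℕₚ.∸-+-assoc n (j + k) j ⟩
  n ∸ (j + k + j)     ≡⟨ cong (n ∸_) (rearrange j k) ⟩
  n ∸ (2 * j + k)     ≡⟨ ℕₚ.∸-+-assoc n (2 * j) k ⟨
  n ∸ 2 * j ∸ k       ∎
  where
  rearrange : ∀ j k → j + k + j ≡ 2 * j + k
  rearrange = ℕSolver.solve-∀
  open ≡-Reasoning

cFormula-offset : ∀ n j k → cFormula n (j + k) j ≡ lucasCoeff (n ∸ 2 * j) k
cFormula-offset n j k = cong₂ entry (ℕₚ.m+n∸m≡n j k) (offset-top n j k)
  where
  entry : ℕ → ℕ → ℚ
  entry d t = (sign d ℚ.* frac (+ (n ∸ 2 * j)) t) ℚ.* ι (t C d)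

entry-offset : ∀ n j k → transitionEntry n (j + k) j ≡ columnCoeff (n ∸ 2 * j) k
entry-offset n j zero    = trans (cong (λ i → transitionEntry n i j) (ℕₚ.+-identityʳ j)) (entry-diagonal n j)
entry-offset n j (suc k) = trans (entry-below n (ℕₚ.m<m+n j (s≤s z≤n))) (cFormula-offset n j (suc k))

half-lower : ∀ n → 2 * (n / 2) ≤ n
half-lower n = subst (_≤ n) (ℕₚ.*-comm (n / 2) 2) (ℕ.m/n*n≤m n 2)

half-upper : ∀ n → n < 2 * suc (n / 2)
half-upper n = subst (_< 2 * suc (n / 2)) (sym (ℕ.m≡m%n+[m/n]*n n 2))
  (subst (n ℕ.% 2 + n / 2 * 2 <_) (sym (ℕₚ.*-suc 2 (n / 2)))
    (ℕₚ.+-mono-<-≤ (ℕ.m%n<n n 2) (ℕₚ.≤-reflexive (ℕₚ.*-comm (n / 2) 2))))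

column-length : ∀ n j → j ≤ n / 2 → n ∸ 2 * j < 2 * (suc (n / 2) ∸ j)
column-length n j j≤N =
  subst (n ∸ 2 * j <_) (sym (ℕₚ.*-distribˡ-∸ 2 (suc (n / 2)) j))
        (ℕₚ.∸-monoˡ-< (half-upper n) (ℕₚ.≤-trans (ℕₚ.*-monoʳ-≤ 2 j≤N) (half-lower n)))

column-identity : ∀ n j → j ≤ n / 2 →
  basisS n j ≈ₚ Σ< (suc (n / 2)) (λ i → transitionEntry n i j ·ₚ basisB n i)
column-identity n j j≤N = ≈ₚ-sym (begin
  Σ< (suc N) g                                 ≈⟨ (λ t → cong (λ z → Σ< z g t) (sym j+K≡)) ⟩
  Σ< (j + K) g                                 ≈⟨ Σ<-dropLeading j K g (λ i i<j → ·ₚ-vanish (basisB n i) (entry-above n i<j)) ⟩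
  Σ< K (λ k → g (j + k))                       ≈⟨ Σ<-cong K summand ⟩
  Σ< K (shiftBy j ∘ term columnCoeff m)        ≈⟨ Σ<-shiftBy j K (term columnCoeff m) ⟩
  shiftBy j (Σ< K (term columnCoeff m))        ≈⟨ shiftBy-cong j (≈ₚ-sym (S-expansion m K (column-length n j j≤N))) ⟩
  shiftBy j (S m)                              ≈⟨ ≈ₚ-sym (basisS≈ n j) ⟩
  basisS n j                                   ∎)
  where
  open ≈ₚ-Reasoning
  N = n / 2
  m = n ∸ 2 * j
  K = suc N ∸ j
  g : ℕ → Poly
  g i = transitionEntry n i j ·ₚ basisB n i
  j+K≡ : j + K ≡ suc N
  j+K≡ = ℕₚ.m+[n∸m]≡n (ℕₚ.m≤n⇒m≤1+n j≤N)
  exponent≡ : ∀ k → n ∸ 2 * (j + k) ≡ m ∸ 2 * k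
  exponent≡ k = trans (cong (n ∸_) (ℕₚ.*-distribˡ-+ 2 j k)) (sym (ℕₚ.∸-+-assoc n (2 * j) (2 * k)))
  summand : ∀ k → g (j + k) ≈ₚ shiftBy j (term columnCoeff m k)
  summand k = begin
    transitionEntry n (j + k) j ·ₚ basisB n (j + k)
        ≈⟨ ·ₚ-congˡ (basisB n (j + k)) (entry-offset n j k) ⟩
    columnCoeff m k ·ₚ basisB n (j + k)
        ≈⟨ ·ₚ-congʳ (columnCoeff m k) (basisB≈ n (j + k)) ⟩
    columnCoeff m k ·ₚ shiftBy (j + k) (onePlusQ^ (n ∸ 2 * (j + k)))
        ≈⟨ ·ₚ-congʳ (columnCoeff m k) (λ t → cong (λ p → p t)
             (trans (shiftBy-+ j k _) (cong (λ e → shiftBy j (shiftBy k (onePlusQ^ e))) (exponent≡ k)))) ⟩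
    columnCoeff m k ·ₚ shiftBy j (shiftBy k (onePlusQ^ (m ∸ 2 * k)))
        ≈⟨ ≈ₚ-sym (shiftBy-·ₚ j (columnCoeff m k) _) ⟩
    shiftBy j (term columnCoeff m k) ∎

sumFinₚ-coefficient-zero : ∀ {M} (f : Fin M → Poly) k → (∀ i → f i k ≡ 0ℚ) → sumFinₚ f k ≡ 0ℚ
sumFinₚ-coefficient-zero {zero}  f k z = refl
sumFinₚ-coefficient-zero {suc M} f k z =
  trans (cong₂ ℚ._+_ (z Fin.zero) (sumFinₚ-coefficient-zero (f ∘ Fin.suc) k (z ∘ Fin.suc))) (ℚₚ.+-identityʳ 0ℚ)

-- Coordinates are unique for a family F_0, ..., F_{M-1} in which F_i vanishes
-- below degree s+i and has coefficient 1 in degree s+i (compare coefficients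
-- in degree s, then recurse on the family F_1, ..., F_{M-1} with s+1).
coordinates-unique : ∀ M (F : Fin M → Poly) s →
  (∀ i k → k < s + toℕ i → F i k ≡ 0ℚ) → (∀ i → F i (s + toℕ i) ≡ 1ℚ) →
  ∀ (a b : Fin M → ℚ) → sumFinₚ (λ i → a i ·ₚ F i) ≈ₚ sumFinₚ (λ i → b i ·ₚ F i) → ∀ i → a i ≡ b i
coordinates-unique (suc M) F s below leading a b a≈b = first-and-rest
  where
  rest-at-s : ∀ (c : Fin (suc M) → ℚ) → sumFinₚ (λ i → c (Fin.suc i) ·ₚ F (Fin.suc i)) s ≡ 0ℚ
  rest-at-s c = sumFinₚ-coefficient-zero _ s
    (λ i → trans (cong (c (Fin.suc i) ℚ.*_) (below (Fin.suc i) s (ℕₚ.m<m+n s (s≤s z≤n)))) (ℚₚ.*-zeroʳ (c (Fin.suc i))))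
  leading₀ : F Fin.zero s ≡ 1ℚ
  leading₀ = subst (λ d → F Fin.zero d ≡ 1ℚ) (ℕₚ.+-identityʳ s) (leading Fin.zero)
  degree-s : ∀ (c : Fin (suc M) → ℚ) → sumFinₚ (λ i → c i ·ₚ F i) s ≡ c Fin.zero
  degree-s c = trans (cong₂ ℚ._+_ (cong (c Fin.zero ℚ.*_) leading₀) (rest-at-s c))
                     (trans (ℚₚ.+-identityʳ _) (ℚₚ.*-identityʳ (c Fin.zero)))
  a₀≡b₀ : a Fin.zero ≡ b Fin.zero
  a₀≡b₀ = trans (sym (degree-s a)) (trans (a≈b s) (degree-s b))
  rest : sumFinₚ (λ i → a (Fin.suc i) ·ₚ F (Fin.suc i)) ≈ₚ sumFinₚ (λ i → b (Fin.suc i) ·ₚ F (Fin.suc i))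
  rest k = +-cancelˡ (b Fin.zero ℚ.* F Fin.zero k) _ _
             (trans (cong (λ x → x ℚ.* F Fin.zero k ℚ.+ _) (sym a₀≡b₀)) (a≈b k))
  first-and-rest : ∀ i → a i ≡ b i
  first-and-rest Fin.zero    = a₀≡b₀
  first-and-rest (Fin.suc i) = coordinates-unique M (F ∘ Fin.suc) (suc s)
    (λ i k k< → below (Fin.suc i) k (subst (k <_) (sym (ℕₚ.+-suc s (toℕ i))) k<))
    (λ i → subst (λ d → F (Fin.suc i) d ≡ 1ℚ) (ℕₚ.+-suc s (toℕ i)) (leading (Fin.suc i)))
    (a ∘ Fin.suc) (b ∘ Fin.suc) rest i

basisB-below : ∀ n i k → k < i → basisB n i k ≡ 0ℚ
basisB-below n i k k<i = trans (basisB≈ n i k) (shiftBy-below i _ k k<i)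

basisB-leading : ∀ n i → basisB n i i ≡ 1ℚ
basisB-leading n i = trans (basisB≈ n i i) (trans (shiftBy-at i _) (onePlusQ^-constant (n ∸ 2 * i)))

claimedMatrix : (n : ℕ) → Fin (suc (n / 2)) → Fin (suc (n / 2)) → ℚ
claimedMatrix n i j = transitionEntry n (toℕ i) (toℕ j)

index-bound : ∀ {N} (j : Fin (suc N)) → toℕ j ≤ N
index-bound j = ℕ.s≤s⁻¹ (Finₚ.toℕ<n j)

claimedMatrix-isTransition : ∀ n → IsTransitionBS n (claimedMatrix n)
claimedMatrix-isTransition n j = ≈ₚ-trans (column-identity n (toℕ j) (index-bound j))
  (≈ₚ-sym (sumFinₚ≈Σ< (suc (n / 2)) (λ i → transitionEntry n i (toℕ j) ·ₚ basisB n i)))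

-- ... and the only one, since B is unitriangular with respect to degree
transition-unique : ∀ n m → IsTransitionBS n m → ∀ i j → m i j ≡ claimedMatrix n i j
transition-unique n m isT i j =
  coordinates-unique (suc (n / 2)) (λ i → basisB n (toℕ i)) 0
    (λ i k → basisB-below n (toℕ i) k) (λ i → basisB-leading n (toℕ i))
    (λ i → m i j) (λ i → claimedMatrix n i j)
    (≈ₚ-trans (≈ₚ-sym (isT j)) (claimedMatrix-isTransition n j)) i

isTransition-resp : ∀ n {m m′} → (∀ i j → m i j ≡ m′ i j) → IsTransitionBS n m → IsTransitionBS n m′
isTransition-resp n m≡m′ isT j =
  ≈ₚ-trans (isT j) (sumFinₚ-cong (λ i → ·ₚ-congˡ (basisB n (toℕ i)) (m≡m′ i j)))

EntryConditions : (n : ℕ) → (Fin (suc (n / 2)) → Fin (suc (n / 2)) → ℚ) → Set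
EntryConditions n m =
  (∀ (i j : Fin (suc (n / 2))) → toℕ i < toℕ j → m i j ≡ 0ℚ)
  × (∀ (j : Fin (suc (n / 2))) → m j j ≡ 1ℚ)
  × (∀ (i j : Fin (suc (n / 2))) → toℕ j ≤ toℕ i →
       ¬ (2 * toℕ i ≡ n × 2 * toℕ j ≡ n) → m i j ≡ cFormula n (toℕ i) (toℕ j))

cFormula-diagonal : ∀ n i → 2 * i < n → cFormula n i i ≡ 1ℚ
cFormula-diagonal n i 2i<n =
  trans (cong (λ r → cFormula n r i) (sym (ℕₚ.+-identityʳ i)))
        (trans (cFormula-offset n i 0)
               (subst (λ e → lucasCoeff e 0 ≡ 1ℚ) (sym (ℕₚ.+-∸-assoc 1 2i<n)) (lucasCoeff-zero (n ∸ suc (2 * i)))))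

conditions⇒claimed : ∀ n m → EntryConditions n m → ∀ i j → m i j ≡ claimedMatrix n i j
conditions⇒claimed n m (above , diagonal , below) i j = by-trichotomy (ℕₚ.<-cmp (toℕ i) (toℕ j))
  where
  by-trichotomy : Trichotomy (toℕ i) (toℕ j) → m i j ≡ claimedMatrix n i j
  by-trichotomy (tri< i<j _ _) = trans (above i j i<j) (sym (entry-above n i<j))
  by-trichotomy (tri≈ _ i≡j _) = begin
    m i j                  ≡⟨ cong (m i) (Finₚ.toℕ-injective (sym i≡j)) ⟩
    m i i                  ≡⟨ diagonal i ⟩
    1ℚ                     ≡⟨ entry-diagonal n (toℕ i) ⟨
    claimedMatrix n i i    ≡⟨ cong (claimedMatrix n i) (Finₚ.toℕ-injective i≡j) ⟩
    claimedMatrix n i j    ∎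
    where open ≡-Reasoning
  by-trichotomy (tri> _ _ j<i) = trans (below i j (ℕₚ.<⇒≤ j<i) not-corner) (sym (entry-below n j<i))
    where
    not-corner : ¬ (2 * toℕ i ≡ n × 2 * toℕ j ≡ n)
    not-corner (2i≡n , 2j≡n) = ℕₚ.<-irrefl (ℕₚ.*-cancelˡ-≡ (toℕ j) (toℕ i) 2 (trans 2j≡n (sym 2i≡n))) j<i

claimed⇒conditions : ∀ n m → (∀ i j → m i j ≡ claimedMatrix n i j) → EntryConditions n m
claimed⇒conditions n m m≡ =
    (λ i j i<j → trans (m≡ i j) (entry-above n i<j))
  , (λ j → trans (m≡ j j) (entry-diagonal n (toℕ j)))
  , below
  where
  below : ∀ i j → toℕ j ≤ toℕ i → ¬ (2 * toℕ i ≡ n × 2 * toℕ j ≡ n) → m i j ≡ cFormula n (toℕ i) (toℕ j)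
  below i j j≤i not-corner = by-cases (ℕₚ.m≤n⇒m<n∨m≡n j≤i)
    where
    by-cases : toℕ j < toℕ i ⊎ toℕ j ≡ toℕ i → m i j ≡ cFormula n (toℕ i) (toℕ j)
    by-cases (inj₁ j<i) = trans (m≡ i j) (entry-below n j<i)
    by-cases (inj₂ j≡i) = begin
      m i j                                  ≡⟨ m≡ i j ⟩
      transitionEntry n (toℕ i) (toℕ j)      ≡⟨ cong (transitionEntry n (toℕ i)) j≡i ⟩
      transitionEntry n (toℕ i) (toℕ i)      ≡⟨ entry-diagonal n (toℕ i) ⟩
      1ℚ                                     ≡⟨ cFormula-diagonal n (toℕ i) 2i<n ⟨
      cFormula n (toℕ i) (toℕ i)             ≡⟨ cong (cFormula n (toℕ i)) j≡i ⟨
      cFormula n (toℕ i) (toℕ j)             ∎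
      where
      open ≡-Reasoning
      2i<n : 2 * toℕ i < n
      2i<n = ℕₚ.≤∧≢⇒< (ℕₚ.≤-trans (ℕₚ.*-monoʳ-≤ 2 (index-bound i)) (half-lower n))
                      (λ 2i≡n → not-corner (2i≡n , subst (λ r → 2 * r ≡ n) (sym j≡i) 2i≡n))

corollary2p11 : (n : ℕ) → (m : Fin (suc (n / 2)) → Fin (suc (n / 2)) → ℚ) →
    IsTransitionBS n m ⇔
      ((∀ (i j : Fin (suc (n / 2))) → toℕ i < toℕ j → m i j ≡ 0ℚ)
       × (∀ (j : Fin (suc (n / 2))) → m j j ≡ 1ℚ)
       × (∀ (i j : Fin (suc (n / 2))) → toℕ j ≤ toℕ i →
            ¬ (2 * toℕ i ≡ n × 2 * toℕ j ≡ n) →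
            m i j ≡ cFormula n (toℕ i) (toℕ j)))
corollary2p11 n m = mk⇔
  (λ isT → claimed⇒conditions n m (transition-unique n m isT))
  (λ conditions → isTransition-resp n (λ i j → sym (conditions⇒claimed n m conditions i j))
                                      (claimedMatrix-isTransition n))
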